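{- For every $n\geq 2$, the Catalan matroid $\mathcal{M}_n=\mathcal{M}[E^nN^n,(EN)^n]$ has exactly $3$ connected components, and its matroid polytope $\mathcal{P}(\mathcal{M}_n)\subset\mathbb{R}^{2n}$ has dimension $2n-3$.
   Context: Lattice paths use steps $E=(1,0)$, $N=(0,1)$, written as words; $\alpha^n$ denotes $n$ concatenated copies of $\alpha$. For lattice paths $P,Q$ from $(0,0)$ to $(m,r)$ with $P$ never above $Q$, $\mathcal{M}[P,Q]$ is the matroid on $[m+r]$ whose bases are the $r$-subsets $B$ such that the lattice path with North steps exactly at the positions in $B$ stays in the region bounded by $P$ and $Q$ (equivalently the transversal matroid with presentation $N_i=[l_i,u_i]$, where $l_i$, $u_i$ are the positions of the $i$-th North step of $Q$ and of $P$). The matroid polytope is $\mathcal{P}(\mathcal{M})=\mathrm{conv}\{\sum_{i\in B}e_i: B\text{ a basis}\}$. Two elements $i,j$ of a matroid are equivalent if some circuit contains both (or $i=j$); the equivalence classes are the connected components. -}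

module Defs where

open import Data.Nat using (ℕ; zero; suc; _+_; _≤_; _<ᵇ_)
open import Data.Nat.Base using (_%_)
open import Data.Bool using (Bool; true; false; if_then_else_)
open import Data.Fin using (Fin; toℕ) renaming (zero to fz; suc to fs)
open import Data.Fin.Subset using (Subset; _⊆_; _⊂_; _∈_; ∣_∣)
open import Data.Vec using (Vec; []; _∷_; tabulate; map; lookup)
open import Data.Product using (Σ; ∃; _×_; _,_)
open import Data.Sum using (_⊎_)
open import Relation.Nullary using (¬_)
open import Relation.Binary.PropositionalEquality using (_≡_)
open import Function.Bundles using (_⇔_)
open import Function.Definitions using (Surjective)
open import Data.Rational using (ℚ; 0ℚ; 1ℚ) renaming (_+_ to _+ℚ_; _*_ to _*ℚ_)

data Step : Set where
  E N : Step

heightAfter : ∀ {m} → Vec Step m → ℕ → ℕ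
heightAfter []       _       = 0
heightAfter (s ∷ w)  zero    = 0
heightAfter (E ∷ w)  (suc k) = heightAfter w k
heightAfter (N ∷ w)  (suc k) = suc (heightAfter w k)

numN : ∀ {m} → Vec Step m → ℕ
numN {m} w = heightAfter w m

pathOf : ∀ {m} → Subset m → Vec Step m
pathOf = map (λ b → if b then N else E)

-- Bases of M[P,Q] (ground set Fin m, positions 0-based): r-subsets B
-- (r = number of N steps of Q) whose path stays weakly between P and Q,
-- i.e. after every k steps its height lies between those of P and Q.
LPMBasis : ∀ {m} → Vec Step m → Vec Step m → Subset m → Set
LPMBasis {m} P Q B =
  (∣ B ∣ ≡ numN Q) ×
  (∀ k → k ≤ m → heightAfter P k ≤ heightAfter (pathOf B) k
                 × heightAfter (pathOf B) k ≤ heightAfter Q k)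

-- E^n N^n and (EN)^n as words of length 2n (position i is 0-based)
lowerCat : (n : ℕ) → Vec Step (n + n)
lowerCat n = tabulate (λ i → if toℕ i <ᵇ n then E else N)

upperCat : (n : ℕ) → Vec Step (n + n)
upperCat n = tabulate (λ i → if toℕ i % 2 <ᵇ 1 then E else N)

CatalanBasis : (n : ℕ) → Subset (n + n) → Set
CatalanBasis n = LPMBasis (lowerCat n) (upperCat n)

module _ {m : ℕ} (Basis : Subset m → Set) where

  Independent : Subset m → Set
  Independent I = ∃ λ B → Basis B × I ⊆ B

  Circuit : Subset m → Set
  Circuit C = ¬ Independent C × (∀ D → D ⊂ C → Independent D)

  Equivalent : Fin m → Fin m → Set
  Equivalent i j = (i ≡ j) ⊎ (∃ λ C → Circuit C × i ∈ C × j ∈ C)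

  -- the equivalence classes of ~ are exactly k in number:
  -- there is a surjective labelling by Fin k whose fibres are the classes
  HasNumComponents : ℕ → Set
  HasNumComponents k =
    Σ (Fin m → Fin k) λ c →
      Surjective _≡_ _≡_ c × (∀ i j → (c i ≡ c j) ⇔ Equivalent i j)

sumℚ : ∀ {k} → (Fin k → ℚ) → ℚ
sumℚ {zero}  f = 0ℚ
sumℚ {suc k} f = f fz +ℚ sumℚ (λ i → f (fs i))

indicator : ∀ {m} → Subset m → Fin m → ℚ
indicator B i = if lookup B i then 1ℚ else 0ℚ

AffinelyIndependent : ∀ {m k} → (Fin k → Fin m → ℚ) → Set
AffinelyIndependent {m} {k} v =
  ∀ (λs : Fin k → ℚ) → sumℚ λs ≡ 0ℚ →
    (∀ (c : Fin m) → sumℚ (λ i → λs i *ℚ v i c) ≡ 0ℚ) →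
    ∀ i → λs i ≡ 0ℚ

AffIndepBases : ∀ {m} → (Subset m → Set) → ℕ → Set
AffIndepBases {m} Basis k =
  Σ (Fin k → Subset m) λ bs → (∀ i → Basis (bs i)) ×
    AffinelyIndependent (λ i → indicator (bs i))

-- dim P(M) = d : the affine hull of the vertices e_B (B a basis), which is
-- the affine hull of their convex hull P(M), has dimension d, i.e. the maximum
-- number of affinely independent vertices is d+1.
PolytopeDim : ∀ {m} → (Subset m → Set) → ℕ → Set
PolytopeDim Basis d =
  AffIndepBases Basis (suc d) × ¬ AffIndepBases Basis (suc (suc d))

-- A basis of M_n is a Dyck path of length 2n: at most ⌊k/2⌋ North steps among
-- the first k and n in total (the lower boundary E^n N^n is then automatic).
-- So position 0 is never a North step (a loop) and position 2n - 1 always is (a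
-- coloop).  Any two positions a < b in between lie in a common circuit: insert
-- one extra North step into the upper path (EN)^n at the first even position
-- e ≥ b, shift the North step just before a onto a if a is even, and take the
-- part up to e; it exceeds the upper path by one at e + 1, but drops back into
-- the Dyck region once any of its elements is deleted.  Hence three components.
-- Every vertex satisfies x₀ = 0, x_{2n-1} = 1 and Σ x = n, so any 2n - 1 of them
-- are affinely dependent by linear algebra on the 2n - 2 middle coordinates;
-- conversely (EN)^n and 2n - 3 one-step modifications of it form a triangular,
-- hence affinely independent, family, so dim P(M_n) = 2n - 3.
module Submission where

open import Defs

open import Data.Bool using (Bool; true; false; if_then_else_; not; _∧_; T)
open import Data.Bool.Properties using (not-involutive)
open import Data.Empty using (⊥; ⊥-elim)
open import Data.Fin as Fin using (Fin; zero; suc; toℕ; fromℕ; fromℕ<; inject₁)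
import Data.Fin.Properties as FinP
open import Data.Fin.Patterns using (0F; 1F; 2F)
open import Data.Fin.Subset using (Subset; _⊆_; _⊂_; _∈_; _∉_; ∣_∣; ⁅_⁆)
open import Data.Fin.Subset.Properties using (x∈⁅x⁆; x∈⁅y⁆⇒x≡y)
open import Data.Nat using (ℕ; zero; suc; _+_; _*_; _∸_; _≤_; _<_; z≤n; s≤s; s≤s⁻¹; _<ᵇ_; _≡ᵇ_; _%_; pred; ⌊_/2⌋; ⌈_/2⌉; >-nonZero)
open import Data.Nat.Properties
open import Algebra.Properties.CommutativeSemigroup +-commutativeSemigroup
  using (interchange; x∙yz≈y∙xz; xy∙z≈xz∙y)
open import Data.Product using (∃; _×_; _,_; proj₁; proj₂)
open import Data.Sum using (_⊎_; inj₁; inj₂)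
open import Data.Unit using (tt)
open import Data.Vec using (Vec; []; _∷_; tabulate; lookup; here; there; _[_]≔_)
import Data.Vec.Properties as VecP
open import Function using (_∘_; _⇔_; mk⇔; Equivalence)
open import Data.Rational using (ℚ; 0ℚ; 1ℚ; 1/_)
  renaming (_+_ to _+ℚ_; _*_ to _*ℚ_; -_ to -ℚ_; _-_ to _-ℚ_)
import Data.Rational as ℚ
import Data.Rational.Properties as ℚP
open import Data.Rational.Solver using (module +-*-Solver)
open import Algebra.Bundles using (CommutativeRing)
open import Algebra.Properties.Semiring.Sum (CommutativeRing.semiring ℚP.+-*-commutativeRing)
  using (sum; sum-cong-≗; sum-replicate-zero; ∑-distrib-+; ∑-comm; *-distribˡ-sum; *-distribʳ-sum; sum-remove; sum-init-last)
open import Algebra.Properties.Semiring.Mult (CommutativeRing.semiring ℚP.+-*-commutativeRing)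
  using () renaming (_×_ to _×ℚ_)
open import Data.Vec.Functional using (insertAt)
open import Data.Vec.Functional.Properties using (insertAt-lookup; insertAt-punchIn)
open import Relation.Binary.Definitions using (tri<; tri≈; tri>)
open import Relation.Binary.PropositionalEquality
open import Relation.Nullary using (¬_; ¬?; yes; no)
open import Relation.Nullary.Reflects using (ofʸ; ofⁿ)

-- Counting and heights

bool→ℕ : Bool → ℕ
bool→ℕ true  = 1
bool→ℕ false = 0

count : (ℕ → Bool) → ℕ → ℕ
count f zero    = 0
count f (suc k) = count f k + bool→ℕ (f k)

count-cong : ∀ {f g} k → (∀ p → p < k → f p ≡ g p) → count f k ≡ count g k
count-cong zero    f≡g = refl
count-cong (suc k) f≡g =
  cong₂ _+_ (count-cong k (λ p p<k → f≡g p (m<n⇒m<1+n p<k))) (cong bool→ℕ (f≡g k ≤-refl))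

count-suc : ∀ f k → count f (suc k) ≡ bool→ℕ (f 0) + count (f ∘ suc) k
count-suc f zero    = sym (+-identityʳ _)
count-suc f (suc k) =
  trans (cong (_+ bool→ℕ (f (suc k))) (count-suc f k)) (+-assoc (bool→ℕ (f 0)) _ _)

isN : Step → Bool
isN E = false
isN N = true

heightAfter-tabulate : ∀ m (g : ℕ → Step) {k} → k ≤ m →
  heightAfter (tabulate {n = m} (g ∘ toℕ)) k ≡ count (isN ∘ g) k
heightAfter-tabulate zero    g z≤n = refl
heightAfter-tabulate (suc m) g z≤n = refl
heightAfter-tabulate (suc m) g {suc k} (s≤s k≤m) = begin
  heightAfter (g 0 ∷ tabulate {n = m} (g ∘ suc ∘ toℕ)) (suc k)  ≡⟨ step (g 0) ⟩
  bool→ℕ (isN (g 0)) + heightAfter (tabulate {n = m} (g ∘ suc ∘ toℕ)) k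
    ≡⟨ cong (bool→ℕ (isN (g 0)) +_) (heightAfter-tabulate m (g ∘ suc) k≤m) ⟩
  bool→ℕ (isN (g 0)) + count (isN ∘ g ∘ suc) k            ≡⟨ count-suc (isN ∘ g) k ⟨
  count (isN ∘ g) (suc k)                                 ∎
  where
  open ≡-Reasoning
  step : ∀ s {w : Vec Step m} → heightAfter (s ∷ w) (suc k) ≡ bool→ℕ (isN s) + heightAfter w k
  step E = refl
  step N = refl

height : ∀ {m} → Subset m → ℕ → ℕ
height B = heightAfter (pathOf B)

toSubset : ∀ {m} → (ℕ → Bool) → Subset m
toSubset f = tabulate (f ∘ toℕ)

∈-toSubset : ∀ {m} (f : ℕ → Bool) {x : Fin m} → x ∈ toSubset f → f (toℕ x) ≡ true
∈-toSubset f {x} x∈ = trans (sym (VecP.lookup∘tabulate (f ∘ toℕ) x)) (VecP.[]=⇒lookup x∈)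

toSubset-∈ : ∀ {m} (f : ℕ → Bool) {x : Fin m} → f (toℕ x) ≡ true → x ∈ toSubset f
toSubset-∈ f {x} fx = VecP.lookup⇒[]= x (toSubset f) (trans (VecP.lookup∘tabulate (f ∘ toℕ) x) fx)

indicator-toSubset : ∀ {m} (f : ℕ → Bool) (c : Fin m) → indicator (toSubset f) c ≡ (if f (toℕ c) then 1ℚ else 0ℚ)
indicator-toSubset f c = cong (λ b → if b then 1ℚ else 0ℚ) (VecP.lookup∘tabulate (f ∘ toℕ) c)

isN-if : ∀ b → isN (if b then N else E) ≡ b
isN-if true  = refl
isN-if false = refl

height-toSubset : ∀ m (f : ℕ → Bool) {k} → k ≤ m → height (toSubset {m} f) k ≡ count f k
height-toSubset m f {k} k≤m = begin
  height (toSubset {m} f) k                                ≡⟨ cong (λ w → heightAfter w k) (VecP.tabulate-∘ {n = m} (λ b → if b then N else E) (f ∘ toℕ)) ⟨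
  heightAfter (tabulate {n = m} ((λ b → if b then N else E) ∘ f ∘ toℕ)) k  ≡⟨ heightAfter-tabulate m _ k≤m ⟩
  count (isN ∘ (λ b → if b then N else E) ∘ f) k          ≡⟨ count-cong k (λ p _ → isN-if (f p)) ⟩
  count f k                                                ∎
  where open ≡-Reasoning

height-cons : ∀ {m} b (B : Subset m) k → height (b ∷ B) (suc k) ≡ bool→ℕ b + height B k
height-cons true  B k = refl
height-cons false B k = refl

height-zero : ∀ {m} (B : Subset m) → height B 0 ≡ 0
height-zero []      = refl
height-zero (_ ∷ _) = refl

∣B∣≡height : ∀ {m} (B : Subset m) → ∣ B ∣ ≡ height B m
∣B∣≡height []          = refl
∣B∣≡height (true ∷ B)  = cong suc (∣B∣≡height B)
∣B∣≡height (false ∷ B) = ∣B∣≡height B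

height-mono-⊆ : ∀ {m} {B C : Subset m} → B ⊆ C → ∀ k → height B k ≤ height C k
height-mono-⊆ {B = []}    {[]}    B⊆C k       = z≤n
height-mono-⊆ {B = _ ∷ _} {_ ∷ _} B⊆C zero    = z≤n
height-mono-⊆ {B = b ∷ B} {c ∷ C} B⊆C (suc k) =
  subst₂ _≤_ (sym (height-cons b B k)) (sym (height-cons c C k))
    (+-mono-≤ (head-≤ b c (B⊆C {zero})) (height-mono-⊆ tail-⊆ k))
  where
  head-≤ : ∀ b c → (zero ∈ b ∷ B → zero ∈ c ∷ C) → bool→ℕ b ≤ bool→ℕ c
  head-≤ false c    _  = z≤n
  head-≤ true  true _  = ≤-refl
  head-≤ true  false h with h here
  ... | ()
  tail-⊆ : B ⊆ C
  tail-⊆ x∈B with B⊆C (there x∈B)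
  ... | there x∈C = x∈C

height-suc≤ : ∀ {m} (B : Subset m) k → height B (suc k) ≤ suc (height B k)
height-suc≤ []      k       = z≤n
height-suc≤ (b ∷ B) zero    rewrite height-cons b B 0 | height-zero B = bit≤1 b
  where
  bit≤1 : ∀ b → bool→ℕ b + 0 ≤ 1
  bit≤1 true  = ≤-refl
  bit≤1 false = z≤n
height-suc≤ (b ∷ B) (suc k) =
  subst₂ _≤_ (sym (height-cons b B (suc k))) (cong suc (sym (height-cons b B k)))
    (subst (bool→ℕ b + height B (suc k) ≤_) (+-suc (bool→ℕ b) (height B k)) (+-monoʳ-≤ (bool→ℕ b) (height-suc≤ B k)))

height-+≤ : ∀ {m} (B : Subset m) k d → height B (k + d) ≤ height B k + d
height-+≤ B k zero    rewrite +-identityʳ k | +-identityʳ (height B k) = ≤-refl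
height-+≤ B k (suc d) rewrite +-suc k d | +-suc (height B k) d =
  ≤-trans (height-suc≤ B (k + d)) (s≤s (height-+≤ B k d))

height-last : ∀ M (B : Subset (suc M)) → height B (suc M) ≡ height B M + bool→ℕ (lookup B (fromℕ M))
height-last zero    (b ∷ []) = trans (height-cons b [] 0) (+-comm (bool→ℕ b) 0)
height-last (suc M) (b ∷ B)  = begin
  height (b ∷ B) (suc (suc M))                      ≡⟨ height-cons b B (suc M) ⟩
  bool→ℕ b + height B (suc M)                       ≡⟨ cong (bool→ℕ b +_) (height-last M B) ⟩
  bool→ℕ b + (height B M + bool→ℕ (lookup B (fromℕ M))) ≡⟨ +-assoc (bool→ℕ b) _ _ ⟨
  bool→ℕ b + height B M + bool→ℕ (lookup B (fromℕ M))   ≡⟨ cong (_+ _) (height-cons b B M) ⟨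
  height (b ∷ B) (suc M) + bool→ℕ (lookup B (fromℕ M))  ∎
  where open ≡-Reasoning

-- The two boundary paths and the Dyck description of the bases

odd : ℕ → Bool
odd zero    = false
odd (suc p) = not (odd p)

odd-suc-suc : ∀ p → odd (suc (suc p)) ≡ odd p
odd-suc-suc p = not-involutive (odd p)

odd-+-false : ∀ q → odd (q + q) ≡ false
odd-+-false zero    = refl
odd-+-false (suc q) rewrite +-suc q q = trans (odd-suc-suc (q + q)) (odd-+-false q)

bool→ℕ-not : ∀ b → bool→ℕ b + bool→ℕ (not b) ≡ 1
bool→ℕ-not true  = refl
bool→ℕ-not false = refl

count-odd : ∀ k → count odd k ≡ ⌊ k /2⌋
count-odd zero          = refl
count-odd (suc zero)    = refl
count-odd (suc (suc k)) = begin
  count odd k + bool→ℕ (odd k) + bool→ℕ (not (odd k))   ≡⟨ +-assoc (count odd k) _ _ ⟩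
  count odd k + (bool→ℕ (odd k) + bool→ℕ (not (odd k))) ≡⟨ cong (count odd k +_) (bool→ℕ-not (odd k)) ⟩
  count odd k + 1                                       ≡⟨ +-comm (count odd k) 1 ⟩
  suc (count odd k)                                     ≡⟨ cong suc (count-odd k) ⟩
  suc ⌊ k /2⌋                                           ∎
  where open ≡-Reasoning

count-odd-+ : ∀ n → count odd (n + n) ≡ n
count-odd-+ n = trans (count-odd (n + n)) (sym (n≡⌊n+n/2⌋ n))

⌊1+n+n/2⌋≡n : ∀ n → ⌊ suc (n + n) /2⌋ ≡ n
⌊1+n+n/2⌋≡n zero    = refl
⌊1+n+n/2⌋≡n (suc n) rewrite +-suc n n = cong suc (⌊1+n+n/2⌋≡n n)

odd≢even : ∀ {p q} → odd p ≡ true → odd q ≡ false → p ≢ q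
odd≢even odd-p even-q refl with trans (sym odd-p) even-q
... | ()

odd-pred : ∀ {a} → 1 ≤ a → odd a ≡ false → odd (pred a) ≡ true
odd-pred {suc p} _ odd-a with odd p
... | true = refl

evenCeil : ℕ → ℕ
evenCeil b = ⌈ b /2⌉ + ⌈ b /2⌉

odd-evenCeil : ∀ b → odd (evenCeil b) ≡ false
odd-evenCeil b = odd-+-false ⌈ b /2⌉

evenCeil-suc-suc : ∀ b → evenCeil (suc (suc b)) ≡ suc (suc (evenCeil b))
evenCeil-suc-suc b = cong suc (+-suc ⌈ b /2⌉ ⌈ b /2⌉)

≤-evenCeil : ∀ b → b ≤ evenCeil b
≤-evenCeil zero          = z≤n
≤-evenCeil (suc zero)    = s≤s z≤n
≤-evenCeil (suc (suc b)) = subst (suc (suc b) ≤_) (sym (evenCeil-suc-suc b)) (s≤s (s≤s (≤-evenCeil b)))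

evenCeil-≡∨odd : ∀ b → evenCeil b ≡ b ⊎ odd b ≡ true
evenCeil-≡∨odd zero          = inj₁ refl
evenCeil-≡∨odd (suc zero)    = inj₂ refl
evenCeil-≡∨odd (suc (suc b)) with evenCeil-≡∨odd b
... | inj₁ eq     = inj₁ (trans (evenCeil-suc-suc b) (cong (λ m → suc (suc m)) eq))
... | inj₂ odd-b  = inj₂ (trans (odd-suc-suc b) odd-b)

isN-upperStep : ∀ p → isN (if p % 2 <ᵇ 1 then E else N) ≡ odd p
isN-upperStep zero          = refl
isN-upperStep (suc zero)    = refl
isN-upperStep (suc (suc p)) = trans (isN-upperStep p) (sym (odd-suc-suc p))

height-upperCat : ∀ n {k} → k ≤ n + n → heightAfter (upperCat n) k ≡ ⌊ k /2⌋
height-upperCat n {k} k≤ = begin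
  heightAfter (upperCat n) k                                 ≡⟨ heightAfter-tabulate (n + n) _ k≤ ⟩
  count (λ p → isN (if p % 2 <ᵇ 1 then E else N)) k         ≡⟨ count-cong k (λ p _ → isN-upperStep p) ⟩
  count odd k                                                ≡⟨ count-odd k ⟩
  ⌊ k /2⌋                                                    ∎
  where open ≡-Reasoning

count-≥ : ∀ n k → count (λ p → not (p <ᵇ n)) k ≡ k ∸ n
count-≥ n zero = sym (0∸n≡0 n)
count-≥ n (suc k) with k <ᵇ n | <ᵇ-reflects-< k n
... | true  | ofʸ k<n = begin
  count (λ p → not (p <ᵇ n)) k + 0 ≡⟨ +-identityʳ _ ⟩
  count (λ p → not (p <ᵇ n)) k     ≡⟨ count-≥ n k ⟩
  k ∸ n                            ≡⟨ m≤n⇒m∸n≡0 (<⇒≤ k<n) ⟩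
  0                                ≡⟨ m≤n⇒m∸n≡0 k<n ⟨
  suc k ∸ n                        ∎
  where open ≡-Reasoning
... | false | ofⁿ k≮n = begin
  count (λ p → not (p <ᵇ n)) k + 1 ≡⟨ cong (_+ 1) (count-≥ n k) ⟩
  k ∸ n + 1                        ≡⟨ +-comm (k ∸ n) 1 ⟩
  suc (k ∸ n)                      ≡⟨ +-∸-assoc 1 (≮⇒≥ k≮n) ⟨
  suc k ∸ n                        ∎
  where open ≡-Reasoning

isN-lowerStep : ∀ b → isN (if b then E else N) ≡ not b
isN-lowerStep true  = refl
isN-lowerStep false = refl

height-lowerCat : ∀ n {k} → k ≤ n + n → heightAfter (lowerCat n) k ≡ k ∸ n
height-lowerCat n {k} k≤ =
  trans (heightAfter-tabulate (n + n) _ k≤)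
    (trans (count-cong k (λ p _ → isN-lowerStep (p <ᵇ n))) (count-≥ n k))

IsDyck : (n : ℕ) → Subset (n + n) → Set
IsDyck n B = height B (n + n) ≡ n × (∀ k → k ≤ n + n → height B k ≤ ⌊ k /2⌋)

k∸n≤h : ∀ {n h k} → k ≤ n + n → n ≤ h + (n + n ∸ k) → k ∸ n ≤ h
k∸n≤h {n} {h} {k} k≤ n≤ = m≤n+o⇒m∸n≤o k n (+-cancelʳ-≤ n k (n + h) (begin
  k + n                   ≤⟨ +-monoʳ-≤ k n≤ ⟩
  k + (h + (n + n ∸ k))   ≡⟨ x∙yz≈y∙xz k h _ ⟩
  h + (k + (n + n ∸ k))   ≡⟨ cong (h +_) (m+[n∸m]≡n k≤) ⟩
  h + (n + n)             ≡⟨ +-assoc h n n ⟨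
  h + n + n               ≡⟨ cong (_+ n) (+-comm h n) ⟩
  n + h + n               ∎))
  where open ≤-Reasoning

catalanBasis⇔isDyck : ∀ n {B} → CatalanBasis n B ⇔ IsDyck n B
catalanBasis⇔isDyck n {B} = mk⇔ to from
  where
  total : heightAfter (upperCat n) (n + n) ≡ n
  total = trans (height-upperCat n ≤-refl) (sym (n≡⌊n+n/2⌋ n))
  to : CatalanBasis n B → IsDyck n B
  to (∣B∣≡ , between) =
    trans (sym (∣B∣≡height B)) (trans ∣B∣≡ total) ,
    λ k k≤ → subst (height B k ≤_) (height-upperCat n k≤) (proj₂ (between k k≤))
  from : IsDyck n B → CatalanBasis n B
  from (end , below) =
    trans (∣B∣≡height B) (trans end (sym total)) ,
    λ k k≤ → subst (_≤ height B k) (sym (height-lowerCat n k≤)) (above k k≤) ,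
             subst (height B k ≤_) (sym (height-upperCat n k≤)) (below k k≤)
    where
    above : ∀ k → k ≤ n + n → k ∸ n ≤ height B k
    above k k≤ = k∸n≤h k≤ (subst (_≤ height B k + (n + n ∸ k))
      (trans (cong (height B) (m+[n∸m]≡n k≤)) end) (height-+≤ B k (n + n ∸ k)))

catalanBasis-toSubset : ∀ n (f : ℕ → Bool) → count f (n + n) ≡ n →
  (∀ k → count f k ≤ count odd k) → CatalanBasis n (toSubset f)
catalanBasis-toSubset n f end below = Equivalence.from (catalanBasis⇔isDyck n {toSubset f})
  (trans (height-toSubset (n + n) f ≤-refl) end ,
   λ k k≤ → subst₂ _≤_ (sym (height-toSubset (n + n) f k≤)) (count-odd k) (below k))

-- Moving North steps

≡ᵇ-refl : ∀ x → (x ≡ᵇ x) ≡ true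
≡ᵇ-refl zero    = refl
≡ᵇ-refl (suc x) = ≡ᵇ-refl x

≢⇒≡ᵇ-false : ∀ {p x} → p ≢ x → (p ≡ᵇ x) ≡ false
≢⇒≡ᵇ-false {p} {x} p≢x with p ≡ᵇ x in eq
... | true  = ⊥-elim (p≢x (≡ᵇ⇒≡ p x (subst T (sym eq) tt)))
... | false = refl

update : (ℕ → Bool) → ℕ → Bool → ℕ → Bool
update f x b p = if p ≡ᵇ x then b else f p

update-≡ : ∀ f x b → update f x b x ≡ b
update-≡ f x b rewrite ≡ᵇ-refl x = refl

update-≢ : ∀ f {x} b {p} → p ≢ x → update f x b p ≡ f p
update-≢ f b p≢x rewrite ≢⇒≡ᵇ-false p≢x = refl

count-≡ᵇ-≥ : ∀ x {j} → j ≤ x → count (_≡ᵇ x) j ≡ 0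
count-≡ᵇ-≥ x {zero}  _   = refl
count-≡ᵇ-≥ x {suc j} j<x rewrite ≢⇒≡ᵇ-false (<⇒≢ {j} {x} j<x) = trans (+-identityʳ _) (count-≡ᵇ-≥ x (<⇒≤ j<x))

count-≡ᵇ-< : ∀ x {j} → x < j → count (_≡ᵇ x) j ≡ 1
count-≡ᵇ-< x {suc j} (s≤s x≤j) with m≤n⇒m<n∨m≡n x≤j
... | inj₁ x<j  rewrite ≢⇒≡ᵇ-false (>⇒≢ x<j) = trans (+-identityʳ _) (count-≡ᵇ-< x x<j)
... | inj₂ refl rewrite ≡ᵇ-refl x | count-≡ᵇ-≥ x (≤-refl {x}) = refl

count-≡ᵇ-antimono : ∀ {x y} j → x ≤ y → count (_≡ᵇ y) j ≤ count (_≡ᵇ x) j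
count-≡ᵇ-antimono {x} {y} j x≤y with j ≤? y
... | yes j≤y = subst (_≤ count (_≡ᵇ x) j) (sym (count-≡ᵇ-≥ y j≤y)) z≤n
... | no  j≰y = ≤-reflexive (trans (count-≡ᵇ-< y y<j) (sym (count-≡ᵇ-< x (≤-<-trans x≤y y<j))))
  where y<j = ≰⇒> j≰y

count-+ : ∀ {f g h} → (∀ p → bool→ℕ (f p) + bool→ℕ (g p) ≡ bool→ℕ (h p)) →
  ∀ j → count f j + count g j ≡ count h j
count-+ fg≡h zero    = refl
count-+ {f} {g} fg≡h (suc j) =
  trans (interchange (count f j) _ (count g j) _) (cong₂ _+_ (count-+ fg≡h j) (fg≡h j))

count-update-true : ∀ f {x} → f x ≡ false → ∀ j →
  count f j + count (_≡ᵇ x) j ≡ count (update f x true) j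
count-update-true f {x} fx = count-+ bits
  where
  bits : ∀ p → bool→ℕ (f p) + bool→ℕ (p ≡ᵇ x) ≡ bool→ℕ (update f x true p)
  bits p with p ≟ x
  ... | yes refl rewrite ≡ᵇ-refl p | fx = refl
  ... | no  p≢x  rewrite ≢⇒≡ᵇ-false p≢x = +-identityʳ _

count-update-false : ∀ f {x} → f x ≡ true → ∀ j →
  count (update f x false) j + count (_≡ᵇ x) j ≡ count f j
count-update-false f {x} fx = count-+ bits
  where
  bits : ∀ p → bool→ℕ (update f x false p) + bool→ℕ (p ≡ᵇ x) ≡ bool→ℕ (f p)
  bits p with p ≟ x
  ... | yes refl rewrite ≡ᵇ-refl p | fx = refl
  ... | no  p≢x  rewrite ≢⇒≡ᵇ-false p≢x = +-identityʳ _

move : (ℕ → Bool) → ℕ → ℕ → ℕ → Bool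
move f r a = update (update f r false) a true

module _ (f : ℕ → Bool) {r a : ℕ} (fr : f r ≡ true) (fa : f a ≡ false) (r<a : r < a) where

  count-move : ∀ j → count (move f r a) j + count (_≡ᵇ r) j ≡ count f j + count (_≡ᵇ a) j
  count-move j = begin
    count (move f r a) j + count (_≡ᵇ r) j
      ≡⟨ cong (_+ _) (count-update-true (update f r false) (trans (update-≢ f false (>⇒≢ r<a)) fa) j) ⟨
    count (update f r false) j + count (_≡ᵇ a) j + count (_≡ᵇ r) j
      ≡⟨ xy∙z≈xz∙y (count (update f r false) j) (count (_≡ᵇ a) j) (count (_≡ᵇ r) j) ⟩
    count (update f r false) j + count (_≡ᵇ r) j + count (_≡ᵇ a) j
      ≡⟨ cong (_+ _) (count-update-false f fr j) ⟩
    count f j + count (_≡ᵇ a) j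
      ∎
    where open ≡-Reasoning

  count-move-≤ : ∀ j → count (move f r a) j ≤ count f j
  count-move-≤ j = +-cancelʳ-≤ (count (_≡ᵇ r) j) _ _ (begin
    count (move f r a) j + count (_≡ᵇ r) j ≡⟨ count-move j ⟩
    count f j + count (_≡ᵇ a) j           ≤⟨ +-monoʳ-≤ (count f j) (count-≡ᵇ-antimono j (<⇒≤ r<a)) ⟩
    count f j + count (_≡ᵇ r) j           ∎)
    where open ≤-Reasoning

  count-move-> : ∀ {j} → a < j → count (move f r a) j ≡ count f j
  count-move-> {j} a<j = +-cancelʳ-≡ 1 _ _ (subst₂ (λ u v → count (move f r a) j + u ≡ count f j + v)
    (count-≡ᵇ-< r (<-trans r<a a<j)) (count-≡ᵇ-< a a<j) (count-move j))

restrict : ℕ → (ℕ → Bool) → ℕ → Bool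
restrict L f p = (p <ᵇ L) ∧ f p

count-restrict : ∀ L f {j} → j ≤ L → count (restrict L f) j ≡ count f j
count-restrict L f {j} j≤L =
  count-cong j (λ p p<j → cong (_∧ f p) (T⇒≡true (<⇒<ᵇ (<-≤-trans p<j j≤L))))
  where
  T⇒≡true : ∀ {b} → T b → b ≡ true
  T⇒≡true {true} _ = refl

module _ {m} (Basis : Subset m → Set) where

  loop-circuit : ∀ {i C} → (∀ B → Basis B → i ∉ B) → Circuit Basis C → i ∈ C →
    ∀ {j} → j ∈ C → j ≡ i
  loop-circuit {i} {C} loop (_ , minimal) i∈C {j} j∈C with j Fin.≟ i
  ... | yes j≡i = j≡i
  ... | no  j≢i with minimal ⁅ i ⁆ (⁅i⁆⊆C , j , j∈C , j≢i ∘ x∈⁅y⁆⇒x≡y i)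
    where
    ⁅i⁆⊆C : ⁅ i ⁆ ⊆ C
    ⁅i⁆⊆C x∈ = subst (_∈ C) (sym (x∈⁅y⁆⇒x≡y i x∈)) i∈C
  ... | B , basis , ⁅i⁆⊆B = ⊥-elim (loop B basis (⁅i⁆⊆B (x∈⁅x⁆ i)))

  coloop-∉-circuit : ∀ {i C} → (∀ B → Basis B → i ∈ B) → Circuit Basis C → i ∉ C
  coloop-∉-circuit {i} {C} coloop (dependent , minimal) i∈C =
    dependent (B , basis , C⊆B)
    where
    C-i : Subset m
    C-i = C [ i ]≔ false
    i∉C-i : i ∉ C-i
    i∉C-i i∈ with trans (sym (VecP.[]=⇒lookup i∈)) (VecP.lookup∘update i C false)
    ... | ()
    C-i≡C : ∀ {x} → x ≢ i → lookup C-i x ≡ lookup C x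
    C-i≡C x≢i = VecP.lookup∘update′ x≢i C false
    C-i⊆C : C-i ⊆ C
    C-i⊆C {x} x∈ with x Fin.≟ i
    ... | yes refl = ⊥-elim (i∉C-i x∈)
    ... | no  x≢i  = VecP.lookup⇒[]= x C (trans (sym (C-i≡C x≢i)) (VecP.[]=⇒lookup x∈))
    independent = minimal C-i (C-i⊆C , i , i∈C , i∉C-i)
    B = proj₁ independent
    basis = proj₁ (proj₂ independent)
    C⊆B : C ⊆ B
    C⊆B {x} x∈ with x Fin.≟ i
    ... | yes refl = coloop B basis
    ... | no  x≢i  = proj₂ (proj₂ independent) (VecP.lookup⇒[]= x C-i (trans (C-i≡C x≢i) (VecP.[]=⇒lookup x∈)))

restrict-true : ∀ L f {p} → restrict L f p ≡ true → p < L × f p ≡ true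
restrict-true L f {p} eq with p <ᵇ L | <ᵇ-reflects-< p L
... | true | ofʸ p<L = p<L , eq

true-restrict : ∀ L f {p} → p < L → f p ≡ true → restrict L f p ≡ true
true-restrict L f {p} p<L fp with p <ᵇ L | <ᵇ-reflects-< p L
... | true  | _       = fp
... | false | ofⁿ p≮L = ⊥-elim (p≮L p<L)

-- Circuits of the Catalan matroid

module _ (n : ℕ) where

  basis-height-end : ∀ {B} → CatalanBasis n B → height B (n + n) ≡ n
  basis-height-end {B} basis = proj₁ (Equivalence.to (catalanBasis⇔isDyck n {B}) basis)

  basis-height-≤ : ∀ {B} → CatalanBasis n B → ∀ k → k ≤ n + n → height B k ≤ ⌊ k /2⌋
  basis-height-≤ {B} basis = proj₂ (Equivalence.to (catalanBasis⇔isDyck n {B}) basis)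

  -- f is the upper path with one extra North step at T, possibly moved
  -- earlier; after T + 1 steps it is one step too high, and that single
  -- excess is all that stops a prefix of f from being independent.
  prefix-circuit : ∀ {T} (f : ℕ → Bool) → suc T ≤ n + n →
    (∀ j → count f j ≤ count odd j + count (_≡ᵇ T) j) →
    count f (n + n) ≡ suc n →
    count f (suc T) ≡ suc (count odd (suc T)) →
    Circuit (CatalanBasis n) (toSubset (restrict (suc T) f))
  prefix-circuit {T} f T<2n f≤ f-end f-excess = dependent , minimal
    where
    C : Subset (n + n)
    C = toSubset (restrict (suc T) f)
    dependent : ¬ Independent (CatalanBasis n) C
    dependent (B , basis , C⊆B) = 1+n≰n (begin
      suc ⌊ suc T /2⌋                      ≡⟨ cong suc (count-odd (suc T)) ⟨
      suc (count odd (suc T))              ≡⟨ f-excess ⟨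
      count f (suc T)                      ≡⟨ count-restrict (suc T) f ≤-refl ⟨
      count (restrict (suc T) f) (suc T)   ≡⟨ height-toSubset (n + n) _ T<2n ⟨
      height C (suc T)                     ≤⟨ height-mono-⊆ C⊆B (suc T) ⟩
      height B (suc T)                     ≤⟨ basis-height-≤ {B} basis (suc T) T<2n ⟩
      ⌊ suc T /2⌋                          ∎)
      where open ≤-Reasoning
    minimal : ∀ D → D ⊂ C → Independent (CatalanBasis n) D
    minimal D (D⊆C , x , x∈C , x∉D) = toSubset g , basis , D⊆B
      where
      x∈f = restrict-true (suc T) f (∈-toSubset (restrict (suc T) f) x∈C)
      x<1+T = proj₁ x∈f
      g = update f (toℕ x) false
      g+1≡f : ∀ j → count g j + count (_≡ᵇ toℕ x) j ≡ count f j
      g+1≡f = count-update-false f (proj₂ x∈f)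
      g-end : count g (n + n) ≡ n
      g-end = +-cancelʳ-≡ 1 _ _ (begin
        count g (n + n) + 1                           ≡⟨ cong (count g (n + n) +_) (count-≡ᵇ-< (toℕ x) (<-≤-trans x<1+T T<2n)) ⟨
        count g (n + n) + count (_≡ᵇ toℕ x) (n + n)   ≡⟨ g+1≡f (n + n) ⟩
        count f (n + n)                               ≡⟨ f-end ⟩
        suc n                                         ≡⟨ +-comm 1 n ⟩
        n + 1                                         ∎)
        where open ≡-Reasoning
      g≤ : ∀ j → count g j ≤ count odd j
      g≤ j = +-cancelʳ-≤ (count (_≡ᵇ toℕ x) j) _ _ (begin
        count g j + count (_≡ᵇ toℕ x) j   ≡⟨ g+1≡f j ⟩
        count f j                         ≤⟨ f≤ j ⟩
        count odd j + count (_≡ᵇ T) j     ≤⟨ +-monoʳ-≤ (count odd j) (count-≡ᵇ-antimono j (≤-pred x<1+T)) ⟩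
        count odd j + count (_≡ᵇ toℕ x) j ∎)
        where open ≤-Reasoning
      basis = catalanBasis-toSubset n g g-end g≤
      D⊆B : D ⊆ toSubset g
      D⊆B {y} y∈D = toSubset-∈ g (trans (update-≢ f false y≢x)
        (proj₂ (restrict-true (suc T) f (∈-toSubset (restrict (suc T) f) (D⊆C y∈D)))))
        where
        y≢x : toℕ y ≢ toℕ x
        y≢x y≡x = x∉D (subst (_∈ D) (FinP.toℕ-injective y≡x) y∈D)

  circuit-containing : ∀ {T} (f : ℕ → Bool) → suc T ≤ n + n →
    (∀ j → count f j ≤ count odd j + count (_≡ᵇ T) j) →
    count f (n + n) ≡ suc n →
    count f (suc T) ≡ suc (count odd (suc T)) →
    ∀ {i j} → toℕ i ≤ T → f (toℕ i) ≡ true → toℕ j ≤ T → f (toℕ j) ≡ true →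
    ∃ λ C → Circuit (CatalanBasis n) C × i ∈ C × j ∈ C
  circuit-containing {T} f T<2n f≤ f-end f-excess i≤T fi j≤T fj =
    toSubset (restrict (suc T) f) , prefix-circuit f T<2n f≤ f-end f-excess ,
    toSubset-∈ (restrict (suc T) f) (true-restrict (suc T) f (s≤s i≤T) fi) ,
    toSubset-∈ (restrict (suc T) f) (true-restrict (suc T) f (s≤s j≤T) fj)

-- The three components

module Catalan (k : ℕ) where

  n : ℕ
  n = suc (suc k)

  -- positions are 0 … n + n ∸ 1 = suc (k + n); the middle ones are 1 … k + n
  last : Fin (n + n)
  last = fromℕ (suc (k + n))

  Basis : Subset (n + n) → Set
  Basis = CatalanBasis n

  zero∉basis : ∀ B → Basis B → zero ∉ B
  zero∉basis (true ∷ _ ∷ B) basis here with basis-height-≤ n {true ∷ _ ∷ B} basis 1 (s≤s z≤n)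
  ... | ()

  k+n≡1+k+1+k : k + n ≡ suc k + suc k
  k+n≡1+k+1+k = +-suc k (suc k)

  k+n≡2+k+k : k + n ≡ 2 + (k + k)
  k+n≡2+k+k = trans k+n≡1+k+1+k (cong suc (+-suc k k))

  ⌊1+k+n/2⌋≡1+k : ⌊ suc (k + n) /2⌋ ≡ suc k
  ⌊1+k+n/2⌋≡1+k = trans (cong (λ m → ⌊ suc m /2⌋) k+n≡1+k+1+k) (⌊1+n+n/2⌋≡n (suc k))

  last∈basis : ∀ B → Basis B → last ∈ B
  last∈basis B basis = VecP.lookup⇒[]= last B (lookup-last (lookup B last) refl)
    where
    end : n ≡ height B (suc (k + n)) + bool→ℕ (lookup B last)
    end = trans (sym (basis-height-end n {B} basis)) (height-last (suc (k + n)) B)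
    below : height B (suc (k + n)) ≤ suc k
    below = subst (height B (suc (k + n)) ≤_) ⌊1+k+n/2⌋≡1+k
      (basis-height-≤ n {B} basis (suc (k + n)) (n≤1+n _))
    lookup-last : ∀ b → lookup B last ≡ b → lookup B last ≡ true
    lookup-last true  eq = eq
    lookup-last false eq = ⊥-elim (1+n≰n (subst (_≤ suc k)
      (trans (sym (+-identityʳ _)) (trans (cong (λ b → height B (suc (k + n)) + bool→ℕ b) (sym eq)) (sym end)))
      below))

  evenCeil-≤ : ∀ {b} → b ≤ k + n → evenCeil b ≤ k + n
  evenCeil-≤ {b} b≤ = subst (evenCeil b ≤_) (sym k+n≡1+k+1+k) (+-mono-≤ ⌈b/2⌉≤ ⌈b/2⌉≤)
    where
    ⌈b/2⌉≤ : ⌈ b /2⌉ ≤ suc k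
    ⌈b/2⌉≤ = subst (⌈ b /2⌉ ≤_) ⌊1+k+n/2⌋≡1+k (⌈n/2⌉-mono b≤)

  middle-circuit : ∀ (i j : Fin (n + n)) → 1 ≤ toℕ i → toℕ i < toℕ j → toℕ j ≤ k + n →
    ∃ λ C → Circuit Basis C × i ∈ C × j ∈ C
  middle-circuit i j 1≤a a<b b≤ = by-parity (odd a) refl
    where
    a = toℕ i
    b = toℕ j
    e = evenCeil b
    b≤e = ≤-evenCeil b
    a<e = <-≤-trans a<b b≤e
    a≤e = <⇒≤ a<e
    e<2n : suc e ≤ n + n
    e<2n = m≤n⇒m≤1+n (s≤s (evenCeil-≤ b≤))
    f₀ = update odd e true
    count-f₀ : ∀ j → count odd j + count (_≡ᵇ e) j ≡ count f₀ j
    count-f₀ = count-update-true odd (odd-evenCeil b)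
    f₀≤ : ∀ j → count f₀ j ≤ count odd j + count (_≡ᵇ e) j
    f₀≤ j = ≤-reflexive (sym (count-f₀ j))
    f₀-end : count f₀ (n + n) ≡ suc n
    f₀-end = trans (sym (count-f₀ (n + n)))
      (trans (cong₂ _+_ (count-odd-+ n) (count-≡ᵇ-< e e<2n)) (+-comm n 1))
    f₀-excess : count f₀ (suc e) ≡ suc (count odd (suc e))
    f₀-excess = trans (sym (count-f₀ (suc e)))
      (trans (cong (count odd (suc e) +_) (count-≡ᵇ-< e ≤-refl)) (+-comm _ 1))
    f₀-a : ∀ {c} → odd a ≡ c → f₀ a ≡ c
    f₀-a = trans (update-≢ odd true (<⇒≢ a<e))
    f₀-b : f₀ b ≡ true
    f₀-b with evenCeil-≡∨odd b
    ... | inj₁ e≡b  = subst (λ x → f₀ x ≡ true) e≡b (update-≡ odd e true)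
    ... | inj₂ odd-b = trans (update-≢ odd true (odd≢even {b} {e} odd-b (odd-evenCeil b))) odd-b
    by-parity : ∀ c → odd a ≡ c → ∃ λ C → Circuit Basis C × i ∈ C × j ∈ C
    by-parity true odd-a =
      circuit-containing n f₀ e<2n f₀≤ f₀-end f₀-excess a≤e (f₀-a odd-a) b≤e f₀-b
    by-parity false odd-a =
      circuit-containing n f₁ e<2n f₁≤ f₁-end f₁-excess a≤e (update-≡ (update f₀ (pred a) false) a true) b≤e f₁-b
      where
      pa<a : pred a < a
      pa<a = ≤-reflexive (suc-pred a {{>-nonZero 1≤a}})
      f₀-pa : f₀ (pred a) ≡ true
      f₀-pa = trans (update-≢ odd true (<⇒≢ (<-trans pa<a a<e))) (odd-pred 1≤a odd-a)
      f₁ = move f₀ (pred a) a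
      f₁≤ : ∀ j → count f₁ j ≤ count odd j + count (_≡ᵇ e) j
      f₁≤ j = ≤-trans (count-move-≤ f₀ f₀-pa (f₀-a odd-a) pa<a j) (f₀≤ j)
      f₁-end : count f₁ (n + n) ≡ suc n
      f₁-end = trans (count-move-> f₀ f₀-pa (f₀-a odd-a) pa<a (<-trans a<e e<2n)) f₀-end
      f₁-excess : count f₁ (suc e) ≡ suc (count odd (suc e))
      f₁-excess = trans (count-move-> f₀ f₀-pa (f₀-a odd-a) pa<a (s≤s a≤e)) f₀-excess
      f₁-b : f₁ b ≡ true
      f₁-b = trans (update-≢ (update f₀ (pred a) false) true (>⇒≢ a<b)) (trans (update-≢ f₀ false (>⇒≢ (<-trans pa<a a<b))) f₀-b)

  data Position (i : Fin (n + n)) : Set where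
    first  : i ≡ zero → Position i
    middle : 1 ≤ toℕ i → toℕ i ≤ k + n → Position i
    final  : i ≡ last → Position i

  position : ∀ i → Position i
  position i with toℕ i in eq
  ... | zero  = first (FinP.toℕ-injective eq)
  ... | suc p with m≤n⇒m<n∨m≡n (s≤s⁻¹ (subst (_< n + n) eq (FinP.toℕ<n i)))
  ...   | inj₁ p<k+n = middle (subst (1 ≤_) (sym eq) (s≤s z≤n)) (subst (_≤ k + n) (sym eq) (s≤s⁻¹ p<k+n))
  ...   | inj₂ refl  = final (FinP.toℕ-injective (trans eq (sym (FinP.toℕ-fromℕ (suc (k + n))))))

  label : ∀ {i} → Position i → Fin 3
  label (first _)    = 0F
  label (middle _ _) = 1F
  label (final _)    = 2F

  componentOf : ℕ → Fin 3
  componentOf zero    = 0F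
  componentOf (suc p) = if p ≡ᵇ k + n then 2F else 1F

  component : Fin (n + n) → Fin 3
  component i = componentOf (toℕ i)

  component-label : ∀ {i} (p : Position i) → component i ≡ label p
  component-label (first refl) = refl
  component-label {i} (middle 1≤i i≤) with toℕ i
  ... | suc p rewrite ≢⇒≡ᵇ-false (<⇒≢ i≤) = refl
  component-label (final refl) rewrite FinP.toℕ-fromℕ (k + n) | ≡ᵇ-refl (k + n) = refl

  middle-equivalent : ∀ {i j} → 1 ≤ toℕ i → toℕ i ≤ k + n → 1 ≤ toℕ j → toℕ j ≤ k + n →
    Equivalent Basis i j
  middle-equivalent {i} {j} 1≤i i≤ 1≤j j≤ with <-cmp (toℕ i) (toℕ j)
  ... | tri< i<j _ _ = inj₂ (middle-circuit i j 1≤i i<j j≤)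
  ... | tri≈ _ i≡j _ = inj₁ (FinP.toℕ-injective i≡j)
  ... | tri> _ _ j<i with middle-circuit j i 1≤j j<i i≤
  ...   | C , circuit , j∈C , i∈C = inj₂ (C , circuit , i∈C , j∈C)

  same-label⇒equivalent : ∀ {i j} (p : Position i) (q : Position j) → label p ≡ label q →
    Equivalent Basis i j
  same-label⇒equivalent (first refl)     (first refl)     _ = inj₁ refl
  same-label⇒equivalent (middle 1≤i i≤)  (middle 1≤j j≤)  _ = middle-equivalent 1≤i i≤ 1≤j j≤
  same-label⇒equivalent (final refl)     (final refl)     _ = inj₁ refl
  same-label⇒equivalent (first _)        (middle _ _)     ()
  same-label⇒equivalent (first _)        (final _)        ()
  same-label⇒equivalent (middle _ _)     (first _)        ()
  same-label⇒equivalent (middle _ _)     (final _)        ()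
  same-label⇒equivalent (final _)        (first _)        ()
  same-label⇒equivalent (final _)        (middle _ _)     ()

  circuit-same-label : ∀ {i j C} → Circuit Basis C → i ∈ C → j ∈ C →
    (p : Position i) (q : Position j) → label p ≡ label q
  circuit-same-label circuit i∈C j∈C (final refl) _ = ⊥-elim (coloop-∉-circuit Basis last∈basis circuit i∈C)
  circuit-same-label circuit i∈C j∈C _ (final refl) = ⊥-elim (coloop-∉-circuit Basis last∈basis circuit j∈C)
  circuit-same-label circuit i∈C j∈C (first refl) q
    rewrite loop-circuit Basis zero∉basis circuit i∈C j∈C with q
  ... | first _    = refl
  ... | middle () _
  circuit-same-label circuit i∈C j∈C p (first refl)
    rewrite loop-circuit Basis zero∉basis circuit j∈C i∈C with p
  ... | first _    = refl
  ... | middle () _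
  circuit-same-label circuit i∈C j∈C (middle _ _) (middle _ _) = refl

  components : HasNumComponents Basis 3
  components = component , surjective , λ i j → mk⇔ (to (position i) (position j)) (from (position i) (position j))
    where
    surjective : ∀ c → ∃ λ i → ∀ {z} → z ≡ i → component z ≡ c
    surjective 0F = zero , λ { refl → refl }
    surjective 1F = suc zero , λ { refl → component-label (middle (s≤s z≤n) (≤-trans (s≤s z≤n) (m≤n+m n k))) }
    surjective 2F = last , λ { refl → component-label (final refl) }
    to : ∀ {i j} (p : Position i) (q : Position j) → component i ≡ component j → Equivalent Basis i j
    to p q c≡c = same-label⇒equivalent p q (trans (sym (component-label p)) (trans c≡c (component-label q)))
    from : ∀ {i j} (p : Position i) (q : Position j) → Equivalent Basis i j → component i ≡ component j
    from p q (inj₁ refl) = refl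
    from p q (inj₂ (C , circuit , i∈C , j∈C)) =
      trans (component-label p) (trans (circuit-same-label circuit i∈C j∈C p q) (sym (component-label q)))

-- Linear algebra over ℚ

sumℚ≡sum : ∀ {k} (f : Fin k → ℚ) → sumℚ f ≡ sum f
sumℚ≡sum {zero}  f = refl
sumℚ≡sum {suc k} f = cong (f zero +ℚ_) (sumℚ≡sum (f ∘ suc))

sum-zero : ∀ {k} (f : Fin k → ℚ) → (∀ i → f i ≡ 0ℚ) → sum f ≡ 0ℚ
sum-zero {k} f f≡0 = trans (sum-cong-≗ f≡0) (sum-replicate-zero k)

sum-single : ∀ {k} (f : Fin k → ℚ) p → (∀ i → i ≢ p → f i ≡ 0ℚ) → sum f ≡ f p
sum-single {suc k} f p others≡0 = begin
  sum f                                 ≡⟨ sum-remove {i = p} f ⟩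
  f p +ℚ sum (f ∘ Fin.punchIn p)        ≡⟨ cong (f p +ℚ_) (sum-zero _ (λ i → others≡0 _ (FinP.punchInᵢ≢i p i))) ⟩
  f p +ℚ 0ℚ                             ≡⟨ ℚP.+-identityʳ (f p) ⟩
  f p                                   ∎
  where open ≡-Reasoning

x*y≡0⇒x≡0 : ∀ x y → x *ℚ y ≡ 0ℚ → y ≢ 0ℚ → x ≡ 0ℚ
x*y≡0⇒x≡0 x y xy≡0 y≢0 = begin
  x                     ≡⟨ ℚP.*-identityʳ x ⟨
  x *ℚ 1ℚ               ≡⟨ cong (x *ℚ_) (ℚP.*-inverseʳ y {{ℚ.≢-nonZero y≢0}}) ⟨
  x *ℚ (y *ℚ y⁻¹)       ≡⟨ ℚP.*-assoc x y y⁻¹ ⟨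
  (x *ℚ y) *ℚ y⁻¹       ≡⟨ cong (_*ℚ y⁻¹) xy≡0 ⟩
  0ℚ *ℚ y⁻¹             ≡⟨ ℚP.*-zeroˡ y⁻¹ ⟩
  0ℚ                    ∎
  where
  open ≡-Reasoning
  y⁻¹ = (1/ y) {{ℚ.≢-nonZero y≢0}}

x-y≡0⇒x≡y : ∀ x y → x -ℚ y ≡ 0ℚ → x ≡ y
x-y≡0⇒x≡y x y x-y≡0 = begin
  x                  ≡⟨ solve 2 (λ x y → x := (x :- y) :+ y) refl x y ⟩
  (x -ℚ y) +ℚ y      ≡⟨ cong (_+ℚ y) x-y≡0 ⟩
  0ℚ +ℚ y            ≡⟨ ℚP.+-identityˡ y ⟩
  y                  ∎
  where
  open ≡-Reasoning
  open +-*-Solver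

IsLinearRelation : ∀ {k m} → (Fin k → ℚ) → (Fin k → Fin m → ℚ) → Set
IsLinearRelation μ v = ∀ c → sum (λ i → μ i *ℚ v i c) ≡ 0ℚ

NontrivialRelation : ∀ {k m} → (Fin k → Fin m → ℚ) → Set
NontrivialRelation v = ∃ λ μ → IsLinearRelation μ v × ∃ λ i → μ i ≢ 0ℚ

-- clears the first coordinate of every vector other than the pivot v p
eliminate : ∀ {k M} (v : Fin (suc k) → Fin (suc M) → ℚ) → Fin (suc k) → Fin k → Fin M → ℚ
eliminate v p i c = v p zero *ℚ v (Fin.punchIn p i) (suc c) -ℚ v (Fin.punchIn p i) zero *ℚ v p (suc c)

zeroColumn-relation : ∀ {k M} (v : Fin (suc k) → Fin (suc M) → ℚ) → (∀ p → v p zero ≡ 0ℚ) →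
  NontrivialRelation (λ i c → v (suc i) (suc c)) → NontrivialRelation v
zeroColumn-relation v first-column-zero (ν , ν-relation , i , ν-i≢0) = insertAt ν zero 0ℚ , relation , suc i , ν-i≢0
  where
  relation : IsLinearRelation (insertAt ν zero 0ℚ) v
  relation zero    = trans (cong₂ _+ℚ_ (ℚP.*-zeroˡ (v zero zero))
    (sum-zero _ (λ i → trans (cong (ν i *ℚ_) (first-column-zero (suc i))) (ℚP.*-zeroʳ (ν i))))) refl
  relation (suc c) = trans (cong₂ _+ℚ_ (ℚP.*-zeroˡ (v zero (suc c))) (ν-relation c)) refl

pivot-relation : ∀ {k M} (v : Fin (suc k) → Fin (suc M) → ℚ) p → v p zero ≢ 0ℚ →
  NontrivialRelation (eliminate v p) → NontrivialRelation v
pivot-relation {k} v p a≢0 (ν , ν-relation , i , ν-i≢0) = μ , relation , Fin.punchIn p i , μ-i≢0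
  where
  open +-*-Solver
  open ≡-Reasoning
  a = v p zero
  b = λ i → v (Fin.punchIn p i) zero
  S = sum (λ i → ν i *ℚ b i)
  μ = insertAt (λ i → a *ℚ ν i) p (-ℚ S)
  μ-i≢0 : μ (Fin.punchIn p i) ≢ 0ℚ
  μ-i≢0 μ-i≡0 = ν-i≢0 (x*y≡0⇒x≡0 (ν i) a
    (trans (ℚP.*-comm (ν i) a) (trans (sym (insertAt-punchIn (λ i → a *ℚ ν i) p (-ℚ S) i)) μ-i≡0)) a≢0)
  split : ∀ c → sum (λ j → μ j *ℚ v j c) ≡ -ℚ S *ℚ v p c +ℚ sum (λ i → (a *ℚ ν i) *ℚ v (Fin.punchIn p i) c)
  split c = trans (sum-remove {i = p} (λ j → μ j *ℚ v j c))
    (cong₂ _+ℚ_ (cong (_*ℚ v p c) (insertAt-lookup (λ i → a *ℚ ν i) p (-ℚ S)))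
      (sum-cong-≗ (λ i → cong (_*ℚ v (Fin.punchIn p i) c) (insertAt-punchIn (λ i → a *ℚ ν i) p (-ℚ S) i))))
  relation : IsLinearRelation μ v
  relation zero = begin
    sum (λ j → μ j *ℚ v j zero)                        ≡⟨ split zero ⟩
    -ℚ S *ℚ a +ℚ sum (λ i → (a *ℚ ν i) *ℚ b i)         ≡⟨ cong (-ℚ S *ℚ a +ℚ_) (sum-cong-≗ (λ i → ℚP.*-assoc a (ν i) (b i))) ⟩
    -ℚ S *ℚ a +ℚ sum (λ i → a *ℚ (ν i *ℚ b i))         ≡⟨ cong (-ℚ S *ℚ a +ℚ_) (*-distribˡ-sum a (λ i → ν i *ℚ b i)) ⟨
    -ℚ S *ℚ a +ℚ a *ℚ S                                ≡⟨ solve 2 (λ s a → (:- s) :* a :+ a :* s := con 0ℚ) refl S a ⟩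
    0ℚ                                                 ∎
  relation (suc c) = begin
    sum (λ j → μ j *ℚ v j (suc c))                     ≡⟨ split (suc c) ⟩
    -ℚ S *ℚ Y +ℚ sum (λ i → (a *ℚ ν i) *ℚ X i)         ≡⟨ cong (-ℚ S *ℚ Y +ℚ_) (sum-cong-≗ regroup) ⟩
    -ℚ S *ℚ Y +ℚ sum (λ i → ν i *ℚ eliminate v p i c +ℚ ν i *ℚ b i *ℚ Y)
      ≡⟨ cong (-ℚ S *ℚ Y +ℚ_) (∑-distrib-+ (λ i → ν i *ℚ eliminate v p i c) (λ i → ν i *ℚ b i *ℚ Y)) ⟩
    -ℚ S *ℚ Y +ℚ (sum (λ i → ν i *ℚ eliminate v p i c) +ℚ sum (λ i → ν i *ℚ b i *ℚ Y))
      ≡⟨ cong₂ (λ x y → -ℚ S *ℚ Y +ℚ (x +ℚ y)) (ν-relation c) (sym (*-distribʳ-sum Y (λ i → ν i *ℚ b i))) ⟩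
    -ℚ S *ℚ Y +ℚ (0ℚ +ℚ S *ℚ Y)                        ≡⟨ solve 2 (λ s y → (:- s) :* y :+ (con 0ℚ :+ s :* y) := con 0ℚ) refl S Y ⟩
    0ℚ                                                 ∎
    where
    Y = v p (suc c)
    X : Fin k → ℚ
    X i = v (Fin.punchIn p i) (suc c)
    regroup : ∀ i → (a *ℚ ν i) *ℚ X i ≡ ν i *ℚ eliminate v p i c +ℚ ν i *ℚ b i *ℚ Y
    regroup i = solve 5 (λ a ν x b y → (a :* ν) :* x := ν :* (a :* x :- b :* y) :+ ν :* b :* y) refl a (ν i) (X i) (b i) Y

sum-linearCombination : ∀ {k m} (μ : Fin k → ℚ) (w : Fin k → Fin m → ℚ) {r} → (∀ i → sum (w i) ≡ r) →
  sum (λ c → sum (λ i → μ i *ℚ w i c)) ≡ sum μ *ℚ r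
sum-linearCombination μ w {r} rows = begin
  sum (λ c → sum (λ i → μ i *ℚ w i c))     ≡⟨ ∑-comm (λ i c → μ i *ℚ w i c) ⟨
  sum (λ i → sum (λ c → μ i *ℚ w i c))     ≡⟨ sum-cong-≗ (λ i → *-distribˡ-sum (μ i) (w i)) ⟨
  sum (λ i → μ i *ℚ sum (w i))             ≡⟨ sum-cong-≗ (λ i → cong (μ i *ℚ_) (rows i)) ⟩
  sum (λ i → μ i *ℚ r)                     ≡⟨ *-distribʳ-sum r μ ⟨
  sum μ *ℚ r                               ∎
  where open ≡-Reasoning

-- by Gaussian elimination on the first coordinate
nontrivialRelation : ∀ M (v : Fin (suc M) → Fin M → ℚ) → NontrivialRelation v
nontrivialRelation zero    v = (λ _ → 1ℚ) , (λ ()) , zero , λ ()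
nontrivialRelation (suc M) v with FinP.any? (λ p → ¬? (v p zero ℚP.≟ 0ℚ))
... | yes (p , a≢0) = pivot-relation v p a≢0 (nontrivialRelation M (eliminate v p))
... | no  no-pivot  = zeroColumn-relation v first-column-zero (nontrivialRelation M (λ i c → v (suc i) (suc c)))
  where
  first-column-zero : ∀ p → v p zero ≡ 0ℚ
  first-column-zero p with v p zero ℚP.≟ 0ℚ
  ... | yes v≡0 = v≡0
  ... | no  v≢0 = ⊥-elim (no-pivot (p , v≢0))

affineRelation⇒differenceRelation : ∀ {m D} (v : Fin (suc D) → Fin m → ℚ) (λs : Fin (suc D) → ℚ) →
  sum λs ≡ 0ℚ → IsLinearRelation λs v → IsLinearRelation (λs ∘ suc) (λ i c → v (suc i) c -ℚ v zero c)
affineRelation⇒differenceRelation {m} {D} v λs Σλ≡0 Σλv≡0 c = begin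
  sum (λ i → λs (suc i) *ℚ d i)
    ≡⟨ ℚP.+-identityˡ _ ⟨
  0ℚ +ℚ sum (λ i → λs (suc i) *ℚ d i)
    ≡⟨ cong (_+ℚ sum (λ i → λs (suc i) *ℚ d i)) (trans (cong (λs zero *ℚ_) (ℚP.+-inverseʳ (v zero c))) (ℚP.*-zeroʳ (λs zero))) ⟨
  sum (λ i → λs i *ℚ (v i c -ℚ v zero c))
    ≡⟨ sum-cong-≗ (λ i → ℚP.*-distribˡ-+ (λs i) (v i c) (-ℚ v zero c)) ⟩
  sum (λ i → λs i *ℚ v i c +ℚ λs i *ℚ (-ℚ v zero c))
    ≡⟨ ∑-distrib-+ (λ i → λs i *ℚ v i c) (λ i → λs i *ℚ (-ℚ v zero c)) ⟩
  sum (λ i → λs i *ℚ v i c) +ℚ sum (λ i → λs i *ℚ (-ℚ v zero c))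
    ≡⟨ cong₂ _+ℚ_ (sym (Σλv≡0 c)) (*-distribʳ-sum (-ℚ v zero c) λs) ⟨
  0ℚ +ℚ sum λs *ℚ (-ℚ v zero c)
    ≡⟨ cong (λ s → 0ℚ +ℚ s *ℚ (-ℚ v zero c)) Σλ≡0 ⟩
  0ℚ +ℚ 0ℚ *ℚ (-ℚ v zero c)
    ≡⟨ cong (0ℚ +ℚ_) (ℚP.*-zeroˡ (-ℚ v zero c)) ⟩
  0ℚ
    ∎
  where
  open ≡-Reasoning
  d : Fin D → ℚ
  d i = v (suc i) c -ℚ v zero c

triangular⇒affinelyIndependent : ∀ {m D} (v : Fin (suc D) → Fin m → ℚ) (coord : Fin D → Fin m) →
  (∀ k → v (suc k) (coord k) ≢ v zero (coord k)) →
  (∀ k i → toℕ k < toℕ i → v (suc i) (coord k) ≡ v zero (coord k)) →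
  AffinelyIndependent v
triangular⇒affinelyIndependent {m} {D} v coord leaves stays λs Σλ≡0 Σλv≡0 = all-zero
  where
  d : Fin D → Fin m → ℚ
  d i c = v (suc i) c -ℚ v zero c
  Σλ≡0′ : sum λs ≡ 0ℚ
  Σλ≡0′ = trans (sym (sumℚ≡sum λs)) Σλ≡0
  differences : IsLinearRelation (λs ∘ suc) d
  differences = affineRelation⇒differenceRelation v λs Σλ≡0′
    (λ c → trans (sym (sumℚ≡sum (λ i → λs i *ℚ v i c))) (Σλv≡0 c))
  vanish-below : ∀ j k → toℕ k < j → λs (suc k) ≡ 0ℚ
  vanish-below (suc j) k (s≤s k≤j) with m≤n⇒m<n∨m≡n k≤j
  ... | inj₁ k<j = vanish-below j k k<j
  ... | inj₂ k≡j = x*y≡0⇒x≡0 (λs (suc k)) (d k (coord k))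
    (trans (sym (sum-single (λ i → λs (suc i) *ℚ d i (coord k)) k others)) (differences (coord k)))
    (leaves k ∘ x-y≡0⇒x≡y _ _)
    where
    others : ∀ i → i ≢ k → λs (suc i) *ℚ d i (coord k) ≡ 0ℚ
    others i i≢k with <-cmp (toℕ i) (toℕ k)
    ... | tri< i<k _ _ = trans (cong (_*ℚ d i (coord k)) (vanish-below j i (subst (toℕ i <_) k≡j i<k)))
                               (ℚP.*-zeroˡ (d i (coord k)))
    ... | tri≈ _ i≡k _ = ⊥-elim (i≢k (FinP.toℕ-injective i≡k))
    ... | tri> _ _ i>k = trans (cong (λ x → λs (suc i) *ℚ (x -ℚ v zero (coord k))) (stays k i i>k))
                               (trans (cong (λs (suc i) *ℚ_) (ℚP.+-inverseʳ (v zero (coord k))))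
                                      (ℚP.*-zeroʳ (λs (suc i))))
  all-zero : ∀ i → λs i ≡ 0ℚ
  all-zero (suc k) = vanish-below (suc (toℕ k)) k ≤-refl
  all-zero zero    = begin
    λs zero                           ≡⟨ ℚP.+-identityʳ (λs zero) ⟨
    λs zero +ℚ 0ℚ                     ≡⟨ cong (λs zero +ℚ_) (sum-zero _ (all-zero ∘ suc)) ⟨
    λs zero +ℚ sum (λs ∘ suc)         ≡⟨ Σλ≡0′ ⟩
    0ℚ                                ∎
    where open ≡-Reasoning

sum-indicator : ∀ {m} (B : Subset m) → sum (indicator B) ≡ ∣ B ∣ ×ℚ 1ℚ
sum-indicator []          = refl
sum-indicator (true ∷ B)  = cong (1ℚ +ℚ_) (sum-indicator B)
sum-indicator (false ∷ B) = trans (ℚP.+-identityˡ _) (sum-indicator B)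

×ℚ1-nonNegative : ∀ k → ℚ.NonNegative (k ×ℚ 1ℚ)
×ℚ1-nonNegative zero    = _
×ℚ1-nonNegative (suc k) = ℚP.nonNeg+nonNeg⇒nonNeg 1ℚ (k ×ℚ 1ℚ) {{×ℚ1-nonNegative k}}

1+k×ℚ1≢0 : ∀ k → 1ℚ +ℚ k ×ℚ 1ℚ ≢ 0ℚ
1+k×ℚ1≢0 k = ℚP.<⇒≢ (ℚP.positive⁻¹ _ {{positive}}) ∘ sym
  where positive = ℚP.pos+nonNeg⇒pos 1ℚ (k ×ℚ 1ℚ) {{×ℚ1-nonNegative k}}

x*[2+k]≡x⇒x≡0 : ∀ k x → x *ℚ (suc (suc k) ×ℚ 1ℚ) ≡ x → x ≡ 0ℚ
x*[2+k]≡x⇒x≡0 k x x*[2+k]≡x = x*y≡0⇒x≡0 x (1ℚ +ℚ k ×ℚ 1ℚ) (begin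
  x *ℚ (1ℚ +ℚ k ×ℚ 1ℚ)                   ≡⟨ solve 2 (λ x q → x :* (con 1ℚ :+ q) := x :* (con 1ℚ :+ (con 1ℚ :+ q)) :- x) refl x (k ×ℚ 1ℚ) ⟩
  x *ℚ (suc (suc k) ×ℚ 1ℚ) -ℚ x          ≡⟨ cong (_-ℚ x) x*[2+k]≡x ⟩
  x -ℚ x                                 ≡⟨ ℚP.+-inverseʳ x ⟩
  0ℚ                                     ∎) (1+k×ℚ1≢0 k)
  where
  open ≡-Reasoning
  open +-*-Solver

-- The dimension of the Catalan matroid polytope

module Polytope (k : ℕ) where

  open Catalan k

  indicator-zero : ∀ {B} → Basis B → indicator B zero ≡ 0ℚ
  indicator-zero {B} basis with lookup B zero in eq
  ... | true  = ⊥-elim (zero∉basis B basis (VecP.lookup⇒[]= zero B eq))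
  ... | false = refl

  indicator-last : ∀ {B} → Basis B → indicator B last ≡ 1ℚ
  indicator-last {B} basis = cong (λ b → if b then 1ℚ else 0ℚ) (VecP.[]=⇒lookup (last∈basis B basis))

  sum-indicator-basis : ∀ {B} → Basis B → sum (indicator B) ≡ n ×ℚ 1ℚ
  sum-indicator-basis {B} basis =
    trans (sum-indicator B) (cong (_×ℚ 1ℚ) (trans (∣B∣≡height B) (basis-height-end n {B} basis)))

  affinelyDependent : ¬ AffIndepBases Basis (suc (k + n))
  affinelyDependent (bs , basis , independent) = μ-i≢0 (independent μ Σμ≡0 affine i)
    where
    open ≡-Reasoning
    interior : Fin (suc (k + n)) → Fin (k + n) → ℚ
    interior i c = indicator (bs i) (suc (inject₁ c))
    relation = nontrivialRelation (k + n) interior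
    μ = proj₁ relation
    i = proj₁ (proj₂ (proj₂ relation))
    μ-i≢0 = proj₂ (proj₂ (proj₂ relation))
    s = sum μ
    G : Fin (n + n) → ℚ
    G c = sum (λ i → μ i *ℚ indicator (bs i) c)
    G-zero : G zero ≡ 0ℚ
    G-zero = sum-zero _ λ i → trans (cong (μ i *ℚ_) (indicator-zero {bs i} (basis i))) (ℚP.*-zeroʳ (μ i))
    G-last : G last ≡ s
    G-last = sum-cong-≗ λ i → trans (cong (μ i *ℚ_) (indicator-last {bs i} (basis i))) (ℚP.*-identityʳ (μ i))
    ΣG≡s : sum G ≡ s
    ΣG≡s = begin
      G zero +ℚ sum (G ∘ suc)                                     ≡⟨ cong₂ _+ℚ_ G-zero (sum-init-last (G ∘ suc)) ⟩
      0ℚ +ℚ (sum (λ c → G (suc (inject₁ c))) +ℚ G last)           ≡⟨ cong (λ x → 0ℚ +ℚ (x +ℚ G last)) (sum-zero _ (proj₁ (proj₂ relation))) ⟩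
      0ℚ +ℚ (0ℚ +ℚ G last)                                        ≡⟨ trans (ℚP.+-identityˡ _) (ℚP.+-identityˡ _) ⟩
      G last                                                      ≡⟨ G-last ⟩
      s                                                           ∎
    ΣG≡s*n : sum G ≡ s *ℚ (n ×ℚ 1ℚ)
    ΣG≡s*n = sum-linearCombination μ (indicator ∘ bs) (λ i → sum-indicator-basis {bs i} (basis i))
    s≡0 : s ≡ 0ℚ
    s≡0 = x*[2+k]≡x⇒x≡0 k s (trans (sym ΣG≡s*n) ΣG≡s)
    G≡0 : ∀ c → G c ≡ 0ℚ
    G≡0 zero    = G-zero
    G≡0 (suc c) with k + n ≟ toℕ c
    ... | yes k+n≡c = trans (cong (G ∘ suc) c≡last) (trans G-last s≡0)
      where c≡last = FinP.toℕ-injective (trans (sym k+n≡c) (sym (FinP.toℕ-fromℕ (k + n))))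
    ... | no  k+n≢c = subst (λ c → G (suc c) ≡ 0ℚ) (FinP.inject₁-lower₁ c k+n≢c)
                        (proj₁ (proj₂ relation) (Fin.lower₁ c k+n≢c))
    Σμ≡0 : sumℚ μ ≡ 0ℚ
    Σμ≡0 = trans (sumℚ≡sum μ) s≡0
    affine : ∀ c → sumℚ (λ i → μ i *ℚ indicator (bs i) c) ≡ 0ℚ
    affine c = trans (sumℚ≡sum (λ i → μ i *ℚ indicator (bs i) c)) (G≡0 c)

  -- Modification j moves one North step of the upper path, from source j to
  -- target j; the coordinate witness j is where it first differs from the
  -- upper path, and no later modification touches that coordinate.
  source target witness : ℕ → ℕ
  source  j = if odd j then j else suc j
  target  j = if odd j then 3 + j else 2 + j
  witness j = if odd j then j else 2 + j

  odd-source : ∀ j → odd (source j) ≡ true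
  odd-source j with odd j in odd-j
  ... | true  = odd-j
  ... | false = cong not odd-j

  odd-target : ∀ j → odd (target j) ≡ false
  odd-target j with odd j in odd-j
  ... | true  = trans (odd-suc-suc (suc j)) (cong not odd-j)
  ... | false = trans (odd-suc-suc j) odd-j

  ≤-source : ∀ j → j ≤ source j
  ≤-source j with odd j
  ... | true  = ≤-refl
  ... | false = n≤1+n j

  source<target : ∀ j → source j < target j
  source<target j with odd j
  ... | true  = m≤n+m (suc j) 2
  ... | false = ≤-refl

  target≤3+j : ∀ j → target j ≤ 3 + j
  target≤3+j j with odd j
  ... | true  = ≤-refl
  ... | false = n≤1+n _

  2+j<target : ∀ {j i} → j < i → 2 + j < target i
  2+j<target {j} {i} j<i with odd i
  ... | true  = s≤s (s≤s (s≤s (<⇒≤ j<i)))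
  ... | false = s≤s (s≤s j<i)

  moved : ℕ → ℕ → Bool
  moved j = move odd (source j) (target j)

  moved-witness : ∀ j → moved j (witness j) ≡ not (odd (witness j))
  moved-witness j with odd j in odd-j
  ... | true  = trans (update-≢ (update odd j false) true (<⇒≢ (m≤n+m (suc j) 2)))
                      (trans (update-≡ odd j false) (cong not (sym odd-j)))
  ... | false = trans (update-≡ (update odd (suc j) false) (2 + j) true)
                      (cong not (sym (trans (odd-suc-suc j) odd-j)))

  moved-stays : ∀ {j i} → j < i → moved i (witness j) ≡ odd (witness j)
  moved-stays {j} {i} j<i with odd j in odd-j
  ... | true  = trans (update-≢ (update odd (source i) false) true (<⇒≢ (<-trans j<source (source<target i))))
                      (update-≢ odd false (<⇒≢ j<source))
    where j<source = <-≤-trans j<i (≤-source i)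
  ... | false = trans (update-≢ (update odd (source i) false) true (<⇒≢ (2+j<target j<i)))
                      (update-≢ odd false (odd≢even {source i} {2 + j} (odd-source i) (trans (odd-suc-suc j) odd-j) ∘ sym))

  D : ℕ
  D = suc (k + k)

  3+j<n+n : ∀ {j} → j < D → 3 + j < n + n
  3+j<n+n {j} j<D = subst (4 + j ≤_) (cong (2 +_) (sym k+n≡2+k+k)) (s≤s (s≤s (s≤s j<D)))

  witness<n+n : ∀ j → j < D → witness j < n + n
  witness<n+n j j<D = ≤-<-trans (witness≤3+j j) (3+j<n+n j<D)
    where
    witness≤3+j : ∀ j → witness j ≤ 3 + j
    witness≤3+j j with odd j
    ... | true  = m≤n+m j 3
    ... | false = n≤1+n _

  target<n+n : ∀ j → j < D → target j < n + n
  target<n+n j j<D = ≤-<-trans (target≤3+j j) (3+j<n+n j<D)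

  vertex : Fin (suc D) → Subset (n + n)
  vertex zero    = toSubset odd
  vertex (suc j) = toSubset (moved (toℕ j))

  vertex-basis : ∀ i → Basis (vertex i)
  vertex-basis zero    = catalanBasis-toSubset n odd (count-odd-+ n) (λ _ → ≤-refl)
  vertex-basis (suc j) = catalanBasis-toSubset n (moved (toℕ j))
    (trans (count-move-> odd (odd-source (toℕ j)) (odd-target (toℕ j)) (source<target (toℕ j))
                         (target<n+n (toℕ j) (FinP.toℕ<n j)))
           (count-odd-+ n))
    (count-move-≤ odd (odd-source (toℕ j)) (odd-target (toℕ j)) (source<target (toℕ j)))

  coordinate : Fin D → Fin (n + n)
  coordinate j = fromℕ< (witness<n+n (toℕ j) (FinP.toℕ<n j))

  indicator-coordinate : ∀ f j → indicator (toSubset f) (coordinate j) ≡ (if f (witness (toℕ j)) then 1ℚ else 0ℚ)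
  indicator-coordinate f j = trans (indicator-toSubset f (coordinate j))
    (cong (λ c → if f c then 1ℚ else 0ℚ) (FinP.toℕ-fromℕ< (witness<n+n (toℕ j) (FinP.toℕ<n j))))

  affinelyIndependent : AffIndepBases Basis (suc D)
  affinelyIndependent = vertex , vertex-basis ,
    triangular⇒affinelyIndependent (λ i → indicator (vertex i)) coordinate leaves stays
    where
    flip≢ : ∀ b → (if not b then 1ℚ else 0ℚ) ≢ (if b then 1ℚ else 0ℚ)
    flip≢ true  ()
    flip≢ false ()
    leaves : ∀ j → indicator (vertex (suc j)) (coordinate j) ≢ indicator (vertex zero) (coordinate j)
    leaves j eq = flip≢ (odd (witness (toℕ j))) (begin
      (if not (odd (witness (toℕ j))) then 1ℚ else 0ℚ)    ≡⟨ cong (λ b → if b then 1ℚ else 0ℚ) (moved-witness (toℕ j)) ⟨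
      (if moved (toℕ j) (witness (toℕ j)) then 1ℚ else 0ℚ) ≡⟨ indicator-coordinate (moved (toℕ j)) j ⟨
      indicator (vertex (suc j)) (coordinate j)           ≡⟨ eq ⟩
      indicator (vertex zero) (coordinate j)              ≡⟨ indicator-coordinate odd j ⟩
      (if odd (witness (toℕ j)) then 1ℚ else 0ℚ)          ∎)
      where open ≡-Reasoning
    stays : ∀ j i → toℕ j < toℕ i → indicator (vertex (suc i)) (coordinate j) ≡ indicator (vertex zero) (coordinate j)
    stays j i j<i = trans (indicator-coordinate (moved (toℕ i)) j)
      (trans (cong (λ b → if b then 1ℚ else 0ℚ) (moved-stays j<i)) (sym (indicator-coordinate odd j)))

  dimension : PolytopeDim Basis D
  dimension = affinelyIndependent , subst (λ d → ¬ AffIndepBases Basis (suc d)) k+n≡2+k+k affinelyDependent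

mainTheorem2 : (n : ℕ) → 2 ≤ n →
    HasNumComponents (CatalanBasis n) 3 × PolytopeDim (CatalanBasis n) (2 * n ∸ 3)
mainTheorem2 (suc (suc k)) (s≤s (s≤s z≤n)) =
  Catalan.components k ,
  subst (PolytopeDim (CatalanBasis (suc (suc k)))) 2n-3≡1+k+k (Polytope.dimension k)
  where
  2n-3≡1+k+k : suc (k + k) ≡ 2 * suc (suc k) ∸ 3
  2n-3≡1+k+k = cong (_∸ 1) (sym (trans (cong (k +_) (cong (λ m → suc (suc m)) (+-identityʳ k))) (Catalan.k+n≡2+k+k k)))
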